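{- Let $n\ge0$, $\rho\in\mathfrak S_n$ and $\xi:=\mathrm F_2'(\rho)$. Then $(\mathrm{pix},\mathrm{inv})\,\xi=(\mathrm{pix},\mathrm{imaj})\,\rho$.
   Context: Permutations are words $\sigma(1)\cdots\sigma(n)$. $\mathrm{DES}\,\pi=\{i:\pi(i)>\pi(i+1)\}$, $\mathrm{maj}\,\pi=\sum_{i\in\mathrm{DES}\,\pi}i$, $\mathrm{IDES}\,\pi=\mathrm{DES}\,\pi^{ -1}$, $\mathrm{imaj}\,\pi=\sum_{i\in\mathrm{IDES}\,\pi}i$, $\mathrm{inv}\,\pi=\#\{(i,j):i<j,\ \pi(i)>\pi(j)\}$. A word $y_1\cdots y_m$ with distinct letters is a desarrangement if $y_1>\dots>y_{2k}<y_{2k+1}$ for some $k\ge1$ (convention $y_{m+1}=\infty$). Each $\sigma$ factors uniquely as $\sigma^p\sigma^d$ with $\sigma^p$ increasing and $\sigma^d$ the longest right factor of $\sigma$ that is a desarrangement; $\mathrm{pix}\,\sigma$ is the length of $\sigma^p$. $\mathrm F_2$ denotes Foata's second fundamental transformation, a bijection of $\mathfrak S_n$ onto itself with $\mathrm{inv}\,\mathrm F_2(\pi)=\mathrm{maj}\,\pi$ and $\mathrm{IDES}\,\mathrm F_2(\pi)=\mathrm{IDES}\,\pi$; $\mathrm F_2'(\pi):=(\mathrm F_2(\pi^{ -1}))^{ -1}$, so that $\mathrm{inv}\,\mathrm F_2'(\pi)=\mathrm{imaj}\,\pi$ and $\mathrm{DES}\,\mathrm F_2'(\pi)=\mathrm{DES}\,\pi$.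 -}

module Defs where

open import Data.Bool using (Bool; true; false; if_then_else_; _∧_)
open import Data.Nat using (ℕ; zero; suc; _+_; _<ᵇ_; _≡ᵇ_)
open import Data.List using (List; []; _∷_; _++_; [_]; map; upTo; length)
open import Data.Nat.ListAction using (sum)
open import Data.Maybe using (Maybe; just; nothing)

-- Words are lists of natural numbers.  A permutation of [n] is represented by
-- its word σ(1)⋯σ(n), with letters 0,…,n-1 (only relative order matters).

lastL : List ℕ → Maybe ℕ
lastL []           = nothing
lastL (x ∷ [])     = just x
lastL (x ∷ y ∷ ys) = lastL (y ∷ ys)

-- Descents, maj, inv  (positions are 1-based, as in the paper)

desFrom : ℕ → List ℕ → List ℕ
desFrom k []           = []
desFrom k (x ∷ [])     = []
desFrom k (x ∷ y ∷ ys) =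
  if y <ᵇ x then (suc k) ∷ desFrom (suc k) (y ∷ ys) else desFrom (suc k) (y ∷ ys)

DES : List ℕ → List ℕ
DES = desFrom 0

maj : List ℕ → ℕ
maj w = sum (DES w)

countLess : ℕ → List ℕ → ℕ
countLess x []       = 0
countLess x (y ∷ ys) = (if y <ᵇ x then 1 else 0) + countLess x ys

inv : List ℕ → ℕ
inv []       = 0
inv (x ∷ xs) = countLess x xs + inv xs

indexOf : ℕ → List ℕ → ℕ
indexOf j []       = 0
indexOf j (y ∷ ys) = if j ≡ᵇ y then 0 else suc (indexOf j ys)

invW : List ℕ → List ℕ
invW w = map (λ j → indexOf j w) (upTo (length w))

IDES : List ℕ → List ℕ
IDES w = DES (invW w)

imaj : List ℕ → ℕ
imaj w = maj (invW w)

decRun : List ℕ → ℕ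
decRun []           = 0
decRun (x ∷ [])     = 1
decRun (x ∷ y ∷ ys) = if y <ᵇ x then suc (decRun (y ∷ ys)) else 1

even? : ℕ → Bool
even? zero          = true
even? (suc zero)    = false
even? (suc (suc n)) = even? n

-- y is a desarrangement iff y₁ > ⋯ > y_{2k} < y_{2k+1} for some k ≥ 1
-- (y_{m+1} = ∞).  Since y_{2k} < y_{2k+1} ends the decreasing run, this
-- holds iff the initial decreasing run has even length ≥ 2.
isDesarrangement : List ℕ → Bool
isDesarrangement y with decRun y
... | zero     = false
... | suc zero = false
... | r        = even? r

-- pix σ = length of σ^p, where σ^d is the longest right factor of σ that is a
-- desarrangement: scan the right factors from the longest one.
pix : List ℕ → ℕ
pix []       = 0
pix (x ∷ xs) = if isDesarrangement (x ∷ xs) then 0 else suc (pix xs)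

-- Foata's second fundamental transformation F₂ (Foata 1968):
--   F₂(x) = x,   F₂(w x) = γₓ(F₂(w)) x,
-- where γₓ(v): if the last letter of v is < x, cut v after each letter < x,
-- otherwise cut v after each letter > x; then in each compartment move the
-- last letter to the front.

cycleCompartments : (ℕ → Bool) → List ℕ → List ℕ → List ℕ
cycleCompartments p cur []       = cur
cycleCompartments p cur (y ∷ ys) =
  if p y then (y ∷ cur) ++ cycleCompartments p [] ys
         else cycleCompartments p (cur ++ [ y ]) ys

γ : ℕ → List ℕ → List ℕ
γ x v with lastL v
... | nothing = []
... | just l  = cycleCompartments (if l <ᵇ x then (λ y → y <ᵇ x) else (λ y → x <ᵇ y)) [] v

F₂-from : List ℕ → List ℕ → List ℕ
F₂-from v []       = v
F₂-from v (x ∷ xs) = F₂-from (γ x v ++ [ x ]) xs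

F₂ : List ℕ → List ℕ
F₂ = F₂-from []

F₂′ : List ℕ → List ℕ
F₂′ π = invW (F₂ (invW π))

-- Put π = ρ⁻¹ and σ = F₂(π), so that ξ = σ⁻¹.  F₂ is built letter by letter,
-- F₂(w x) = γₓ(F₂ w) x, and each step keeps inv F₂(w) = maj w and IDES F₂(w) = IDES w:
-- cycling the compartments of γₓ changes inv by exactly what maj gains when x is appended
-- (|w| if x is below the last letter, 0 otherwise), and it preserves the subwords of letters
-- below x and above x, hence the relative order of a and a + 1.  So inv ξ = inv σ = maj π =
-- imaj ρ, and DES ξ = IDES σ = IDES π = DES ρ; since pix depends only on the descent pattern,
-- pix ξ = pix ρ.
module Submission where

open import Defs
open import Data.Bool using (Bool; true; false; if_then_else_; _∨_; not; T)
open import Data.Empty using (⊥-elim)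
open import Data.Nat using (ℕ; zero; suc; _+_; _<ᵇ_; _≡ᵇ_; _<_; _≤_; z≤n; s≤s)
open import Data.Nat.Properties
open import Data.Nat.Solver using (module +-*-Solver)
open import Data.List using (List; []; _∷_; _++_; [_]; map; upTo; applyUpTo; length)
open import Data.Nat.ListAction using (sum)
open import Data.Maybe using (just; nothing)
open import Data.List.Properties
  using (++-assoc; ++-identityʳ; map-++; map-∘; map-cong-local; map-upTo; length-map; length-upTo)
open import Data.List.Relation.Unary.All using (All; []; _∷_)
import Data.List.Relation.Unary.All as All
import Data.List.Relation.Unary.All.Properties as All
open import Data.Product using (_×_; _,_; ∃)
open import Data.List.Relation.Unary.Unique.Propositional using (Unique)
import Data.List.Relation.Unary.Unique.Propositional.Properties as Unique
open import Data.List.Relation.Binary.Permutation.Setoid.Properties using (Unique-resp-↭)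
open import Data.List.Membership.Propositional.Properties.WithK using (unique∧set⇒bag)
open import Data.List.Relation.Binary.BagAndSetEquality using (∼bag⇒↭)
open import Data.List.Relation.Unary.AllPairs using (AllPairs; []; _∷_)
import Data.List.Relation.Unary.AllPairs.Properties as AllPairs
open import Function using (_∘_; id)
open import Function.Bundles using (mk⇔)
open import Relation.Nullary using (¬_; yes; no)
open import Relation.Binary.Definitions using (tri<; tri≈; tri>)
open import Relation.Binary.PropositionalEquality hiding ([_])
open import Data.List.Relation.Binary.Permutation.Propositional as ↭
  using (_↭_; ↭-refl; ↭-trans; ↭-sym; ↭-reflexive; ↭⇒↭ₛ)
open import Data.List.Relation.Binary.Permutation.Propositional.Properties
  using (shift; ++⁺ˡ; ++⁺ʳ; drop-mid; ↭-length; ↭-empty-inv; All-resp-↭; ∈-resp-↭)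
open import Data.List.Relation.Unary.Any using (here; there)
open import Data.List.Membership.Propositional using (_∈_)
open import Data.List.Membership.Propositional.Properties
  using (∈-∃++; ∈-applyUpTo⁺; ∈-applyUpTo⁻; ∈-upTo⁺; ∈-upTo⁻)

open +-*-Solver

<⇒<ᵇ≡true : ∀ {m n} → m < n → (m <ᵇ n) ≡ true
<⇒<ᵇ≡true {zero}  {suc n} _         = refl
<⇒<ᵇ≡true {suc m} {suc n} (s≤s m<n) = <⇒<ᵇ≡true m<n

<ᵇ≡true⇒< : ∀ {m n} → (m <ᵇ n) ≡ true → m < n
<ᵇ≡true⇒< {m} {n} eq = <ᵇ⇒< m n (subst T (sym eq) _)

≮⇒<ᵇ≡false : ∀ {m n} → ¬ m < n → (m <ᵇ n) ≡ false
≮⇒<ᵇ≡false {m} {n} m≮n with m <ᵇ n in eq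
... | true  = ⊥-elim (m≮n (<ᵇ≡true⇒< eq))
... | false = refl

<ᵇ≡false⇒≥ : ∀ {m n} → (m <ᵇ n) ≡ false → n ≤ m
<ᵇ≡false⇒≥ eq = ≮⇒≥ (λ m<n → subst T eq (<⇒<ᵇ m<n))

<ᵇ≡false∧≢⇒> : ∀ {m n} → (m <ᵇ n) ≡ false → m ≢ n → n < m
<ᵇ≡false∧≢⇒> eq m≢n = ≤∧≢⇒< (<ᵇ≡false⇒≥ eq) (≢-sym m≢n)

>⇒<ᵇ≡false : ∀ {m n} → n < m → (m <ᵇ n) ≡ false
>⇒<ᵇ≡false n<m = ≮⇒<ᵇ≡false (<⇒≯ n<m)

≡ᵇ-refl : ∀ n → (n ≡ᵇ n) ≡ true
≡ᵇ-refl zero    = refl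
≡ᵇ-refl (suc n) = ≡ᵇ-refl n

≡ᵇ≡true⇒≡ : ∀ {m n} → (m ≡ᵇ n) ≡ true → m ≡ n
≡ᵇ≡true⇒≡ {m} {n} eq = ≡ᵇ⇒≡ m n (subst T (sym eq) _)

≢⇒≡ᵇ≡false : ∀ {m n} → m ≢ n → (m ≡ᵇ n) ≡ false
≢⇒≡ᵇ≡false {m} {n} m≢n with m ≡ᵇ n in eq
... | true  = ⊥-elim (m≢n (≡ᵇ≡true⇒≡ eq))
... | false = refl

countᵇ : (ℕ → Bool) → List ℕ → ℕ
countᵇ p []       = 0
countᵇ p (y ∷ ys) = (if p y then 1 else 0) + countᵇ p ys

countᵇ-++ : ∀ p xs ys → countᵇ p (xs ++ ys) ≡ countᵇ p xs + countᵇ p ys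
countᵇ-++ p []       ys = refl
countᵇ-++ p (x ∷ xs) ys =
  trans (cong (_ +_) (countᵇ-++ p xs ys)) (sym (+-assoc (if p x then 1 else 0) _ _))

countᵇ-↭ : ∀ p {xs ys} → xs ↭ ys → countᵇ p xs ≡ countᵇ p ys
countᵇ-↭ p ↭.refl              = refl
countᵇ-↭ p (↭.prep x xs↭ys)    = cong (_ +_) (countᵇ-↭ p xs↭ys)
countᵇ-↭ p (↭.swap x y xs↭ys)  rewrite countᵇ-↭ p xs↭ys =
  solve 3 (λ a b c → a :+ (b :+ c) := b :+ (a :+ c)) refl (if p x then 1 else 0) (if p y then 1 else 0) _
countᵇ-↭ p (↭.trans xs↭ys ys↭zs) = trans (countᵇ-↭ p xs↭ys) (countᵇ-↭ p ys↭zs)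

countᵇ-all-true : ∀ p {xs} → All (λ c → p c ≡ true) xs → countᵇ p xs ≡ length xs
countᵇ-all-true p []               = refl
countᵇ-all-true p (px ∷ pxs) rewrite px = cong suc (countᵇ-all-true p pxs)

countᵇ-all-false : ∀ p {xs} → All (λ c → p c ≡ false) xs → countᵇ p xs ≡ 0
countᵇ-all-false p []               = refl
countᵇ-all-false p (px ∷ pxs) rewrite px = countᵇ-all-false p pxs

countGreater : ℕ → List ℕ → ℕ
countGreater x = countᵇ (x <ᵇ_)

countLess≡countᵇ : ∀ x ys → countLess x ys ≡ countᵇ (_<ᵇ x) ys
countLess≡countᵇ x []       = refl
countLess≡countᵇ x (y ∷ ys) = cong (_ +_) (countLess≡countᵇ x ys)

countLess-++ : ∀ x xs ys → countLess x (xs ++ ys) ≡ countLess x xs + countLess x ys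
countLess-++ x xs ys
  rewrite countLess≡countᵇ x (xs ++ ys) | countLess≡countᵇ x xs | countLess≡countᵇ x ys =
  countᵇ-++ _ xs ys

countLess-↭ : ∀ x {xs ys} → xs ↭ ys → countLess x xs ≡ countLess x ys
countLess-↭ x {xs} {ys} xs↭ys
  rewrite countLess≡countᵇ x xs | countLess≡countᵇ x ys = countᵇ-↭ _ xs↭ys

countLess-all< : ∀ {x xs} → All (_< x) xs → countLess x xs ≡ length xs
countLess-all< {x} {xs} all< =
  trans (countLess≡countᵇ x xs) (countᵇ-all-true _ (All.map <⇒<ᵇ≡true all<))

countLess-all> : ∀ {x xs} → All (x <_) xs → countLess x xs ≡ 0
countLess-all> {x} {xs} all> =
  trans (countLess≡countᵇ x xs) (countᵇ-all-false _ (All.map >⇒<ᵇ≡false all>))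

countGreater-all> : ∀ {x xs} → All (x <_) xs → countGreater x xs ≡ length xs
countGreater-all> all> = countᵇ-all-true _ (All.map <⇒<ᵇ≡true all>)

countGreater-all< : ∀ {x xs} → All (_< x) xs → countGreater x xs ≡ 0
countGreater-all< all< = countᵇ-all-false _ (All.map >⇒<ᵇ≡false all<)

countLess+countGreater : ∀ x {xs} → All (_≢ x) xs → countLess x xs + countGreater x xs ≡ length xs
countLess+countGreater x []                   = refl
countLess+countGreater x {y ∷ xs} (y≢x ∷ ≢x) with <-cmp y x
... | tri< y<x _ _ rewrite <⇒<ᵇ≡true y<x | >⇒<ᵇ≡false y<x =
  cong suc (countLess+countGreater x ≢x)
... | tri≈ _ y≡x _ = ⊥-elim (y≢x y≡x)
... | tri> _ _ x<y rewrite <⇒<ᵇ≡true x<y | >⇒<ᵇ≡false x<y =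
  trans (+-suc _ _) (cong suc (countLess+countGreater x ≢x))

crossInv : List ℕ → List ℕ → ℕ
crossInv []       ys = 0
crossInv (x ∷ xs) ys = countLess x ys + crossInv xs ys

inv-++ : ∀ xs ys → inv (xs ++ ys) ≡ inv xs + crossInv xs ys + inv ys
inv-++ []       ys = refl
inv-++ (x ∷ xs) ys rewrite countLess-++ x xs ys | inv-++ xs ys =
  solve 5 (λ a b c d e → (a :+ b) :+ ((c :+ d) :+ e) := ((a :+ c) :+ (b :+ d)) :+ e) refl
    (countLess x xs) (countLess x ys) (inv xs) (crossInv xs ys) (inv ys)

crossInv-∷ : ∀ xs y ys → crossInv xs (y ∷ ys) ≡ countGreater y xs + crossInv xs ys
crossInv-∷ []       y ys = refl
crossInv-∷ (x ∷ xs) y ys rewrite crossInv-∷ xs y ys =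
  solve 4 (λ a b c d → (a :+ b) :+ (c :+ d) := (a :+ c) :+ (b :+ d)) refl
    (if y <ᵇ x then 1 else 0) (countLess x ys) (countGreater y xs) (crossInv xs ys)

crossInv-↭ : ∀ xs {ys zs} → ys ↭ zs → crossInv xs ys ≡ crossInv xs zs
crossInv-↭ []       ys↭zs = refl
crossInv-↭ (x ∷ xs) ys↭zs = cong₂ _+_ (countLess-↭ x ys↭zs) (crossInv-↭ xs ys↭zs)

crossInv-[] : ∀ xs → crossInv xs [] ≡ 0
crossInv-[] []       = refl
crossInv-[] (x ∷ xs) = crossInv-[] xs

inv-∷ʳ : ∀ xs y → inv (xs ++ [ y ]) ≡ inv xs + countGreater y xs
inv-∷ʳ xs y rewrite inv-++ xs [ y ] | crossInv-∷ xs y [] | crossInv-[] xs =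
  trans (+-identityʳ _) (cong (inv xs +_) (+-identityʳ _))

cycleCompartments-↭ : ∀ p cur ys → cycleCompartments p cur ys ↭ cur ++ ys
cycleCompartments-↭ p cur []       = ↭-reflexive (sym (++-identityʳ cur))
cycleCompartments-↭ p cur (y ∷ ys) with p y
... | true  = ↭-trans (↭.prep y (++⁺ˡ cur (cycleCompartments-↭ p [] ys))) (↭-sym (shift y cur ys))
... | false = ↭-trans (cycleCompartments-↭ p (cur ++ [ y ]) ys) (↭-reflexive (++-assoc cur [ y ] ys))

-- Moving a cut letter y from the end of its compartment cur to the front destroys the
-- inversions (c, y) with c > y and creates the inversions (y, c) with c < y.
cyclingLoss : (ℕ → Bool) → List ℕ → List ℕ → ℕ
cyclingLoss p cur []       = 0
cyclingLoss p cur (y ∷ ys) =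
  if p y then countGreater y cur + cyclingLoss p [] ys else cyclingLoss p (cur ++ [ y ]) ys

cyclingGain : (ℕ → Bool) → List ℕ → List ℕ → ℕ
cyclingGain p cur []       = 0
cyclingGain p cur (y ∷ ys) =
  if p y then countLess y cur + cyclingGain p [] ys else cyclingGain p (cur ++ [ y ]) ys

inv-cycleCompartments : ∀ p cur ys →
  inv (cycleCompartments p cur ys) + cyclingLoss p cur ys ≡ inv (cur ++ ys) + cyclingGain p cur ys
inv-cycleCompartments p cur [] rewrite ++-identityʳ cur = refl
inv-cycleCompartments p cur (y ∷ ys) with p y
... | false rewrite sym (++-assoc cur [ y ] ys) = inv-cycleCompartments p (cur ++ [ y ]) ys
... | true
  rewrite inv-++ (y ∷ cur) (cycleCompartments p [] ys)
        | countLess-↭ y (cycleCompartments-↭ p [] ys)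
        | crossInv-↭ cur (cycleCompartments-↭ p [] ys)
        | inv-++ cur (y ∷ ys) | crossInv-∷ cur y ys
  = rearrange (countLess y cur) (inv cur) (countLess y ys) (crossInv cur ys) (countGreater y cur)
      (inv-cycleCompartments p [] ys)
  where
  rearrange : ∀ a b c d f {e g h i} → e + g ≡ h + i →
    a + b + (c + d) + e + (f + g) ≡ b + (f + d) + (c + h) + (a + i)
  rearrange a b c d f {e} {g} {h} {i} e+g≡h+i = begin
    a + b + (c + d) + e + (f + g) ≡⟨ solve 7 (λ a b c d e f g → a :+ b :+ (c :+ d) :+ e :+ (f :+ g)
                                       := (a :+ b :+ c :+ d :+ f) :+ (e :+ g)) refl a b c d e f g ⟩
    (a + b + c + d + f) + (e + g) ≡⟨ cong (a + b + c + d + f +_) e+g≡h+i ⟩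
    (a + b + c + d + f) + (h + i) ≡⟨ solve 7 (λ a b c d f h i → (a :+ b :+ c :+ d :+ f) :+ (h :+ i)
                                       := b :+ (f :+ d) :+ (c :+ h) :+ (a :+ i)) refl a b c d f h i ⟩
    b + (f + d) + (c + h) + (a + i) ∎
    where open ≡-Reasoning

module _ (x : ℕ) where

  cyclingGain-below : ∀ {cur} ys → All (x <_) cur → All (_≢ x) ys → cyclingGain (_<ᵇ x) cur ys ≡ 0
  cyclingGain-below []       _     _            = refl
  cyclingGain-below (y ∷ ys) x<cur (y≢x ∷ ys≢x) with y <ᵇ x in y<ᵇx
  ... | true = cong₂ _+_ (countLess-all> (All.map (<-trans (<ᵇ≡true⇒< y<ᵇx)) x<cur))
                        (cyclingGain-below ys [] ys≢x)
  ... | false = cyclingGain-below ys (All.++⁺ x<cur (<ᵇ≡false∧≢⇒> y<ᵇx y≢x ∷ [])) ys≢x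

  cyclingLoss-below : ∀ {cur} zs {l} → All (x <_) cur → All (_≢ x) zs → l < x →
    cyclingLoss (_<ᵇ x) cur (zs ++ [ l ]) ≡ countGreater x (cur ++ zs ++ [ l ])
  cyclingLoss-below {cur} [] {l} x<cur _ l<x
    rewrite <⇒<ᵇ≡true l<x | countGreater-all> (All.map (<-trans l<x) x<cur)
          | countᵇ-++ (x <ᵇ_) cur [ l ] | countGreater-all> x<cur | >⇒<ᵇ≡false l<x = refl
  cyclingLoss-below {cur} (z ∷ zs) {l} x<cur (z≢x ∷ zs≢x) l<x with z <ᵇ x in z<ᵇx
  ... | true
    rewrite countGreater-all> (All.map (<-trans (<ᵇ≡true⇒< z<ᵇx)) x<cur)
          | countᵇ-++ (x <ᵇ_) cur (z ∷ zs ++ [ l ]) | countGreater-all> x<cur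
          | >⇒<ᵇ≡false {x} {z} (<ᵇ≡true⇒< z<ᵇx) =
    cong (length cur +_) (cyclingLoss-below zs [] zs≢x l<x)
  ... | false rewrite sym (++-assoc cur [ z ] (zs ++ [ l ])) =
    cyclingLoss-below zs (All.++⁺ x<cur (<ᵇ≡false∧≢⇒> z<ᵇx z≢x ∷ [])) zs≢x l<x

  cyclingLoss-above : ∀ {cur} ys → All (_< x) cur → All (_≢ x) ys → cyclingLoss (x <ᵇ_) cur ys ≡ 0
  cyclingLoss-above []       _     _            = refl
  cyclingLoss-above (y ∷ ys) cur<x (y≢x ∷ ys≢x) with x <ᵇ y in x<ᵇy
  ... | true = cong₂ _+_ (countGreater-all< (All.map (λ c<x → <-trans c<x (<ᵇ≡true⇒< x<ᵇy)) cur<x))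
                        (cyclingLoss-above ys [] ys≢x)
  ... | false = cyclingLoss-above ys (All.++⁺ cur<x (<ᵇ≡false∧≢⇒> x<ᵇy (≢-sym y≢x) ∷ [])) ys≢x

  cyclingGain-above : ∀ {cur} zs {l} → All (_< x) cur → All (_≢ x) zs → x < l →
    cyclingGain (x <ᵇ_) cur (zs ++ [ l ]) ≡ countLess x (cur ++ zs ++ [ l ])
  cyclingGain-above {cur} [] {l} cur<x _ x<l
    rewrite <⇒<ᵇ≡true x<l | countLess-all< {l} (All.map (λ c<x → <-trans c<x x<l) cur<x)
          | countLess-++ x cur [ l ] | countLess-all< {x} cur<x | >⇒<ᵇ≡false {l} {x} x<l = refl
  cyclingGain-above {cur} (z ∷ zs) {l} cur<x (z≢x ∷ zs≢x) x<l with x <ᵇ z in x<ᵇz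
  ... | true
    rewrite countLess-all< {z} (All.map (λ c<x → <-trans c<x (<ᵇ≡true⇒< x<ᵇz)) cur<x)
          | countLess-++ x cur (z ∷ zs ++ [ l ]) | countLess-all< {x} cur<x
          | >⇒<ᵇ≡false {z} {x} (<ᵇ≡true⇒< x<ᵇz) =
    cong (length cur +_) (cyclingGain-above zs [] zs≢x x<l)
  ... | false rewrite sym (++-assoc cur [ z ] (zs ++ [ l ])) =
    cyclingGain-above zs (All.++⁺ cur<x (<ᵇ≡false∧≢⇒> x<ᵇz (≢-sym z≢x) ∷ [])) zs≢x x<l

-- inv and maj under one step of F₂

lastL-∷ʳ : ∀ xs y → lastL (xs ++ [ y ]) ≡ just y
lastL-∷ʳ []           y = refl
lastL-∷ʳ (x ∷ [])     y = refl
lastL-∷ʳ (x ∷ z ∷ zs) y = lastL-∷ʳ (z ∷ zs) y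

lastL≡nothing⇒[] : ∀ {xs} → lastL xs ≡ nothing → xs ≡ []
lastL≡nothing⇒[] {[]}         _  = refl
lastL≡nothing⇒[] {x ∷ z ∷ zs} eq with () ← lastL≡nothing⇒[] {z ∷ zs} eq

lastL≡just⇒∷ʳ : ∀ {xs l} → lastL xs ≡ just l → ∃ λ zs → xs ≡ zs ++ [ l ]
lastL≡just⇒∷ʳ {x ∷ []}     refl = [] , refl
lastL≡just⇒∷ʳ {x ∷ z ∷ zs} eq with ys , eq′ ← lastL≡just⇒∷ʳ {z ∷ zs} eq =
  x ∷ ys , cong (x ∷_) eq′

sum-desFrom-∷∷ : ∀ k y z zs →
  sum (desFrom k (y ∷ z ∷ zs)) ≡ (if z <ᵇ y then suc k else 0) + sum (desFrom (suc k) (z ∷ zs))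
sum-desFrom-∷∷ k y z zs with z <ᵇ y
... | true  = refl
... | false = refl

desFrom-∷ʳ : ∀ k xs x l → lastL xs ≡ just l →
  sum (desFrom k (xs ++ [ x ])) ≡ sum (desFrom k xs) + (if x <ᵇ l then k + length xs else 0)
desFrom-∷ʳ k (y ∷ []) x .y refl with x <ᵇ y
... | true  = trans (+-identityʳ (suc k)) (+-comm 1 k)
... | false = refl
desFrom-∷ʳ k (y ∷ z ∷ zs) x l last = begin
  sum (desFrom k (y ∷ z ∷ zs ++ [ x ]))
    ≡⟨ sum-desFrom-∷∷ k y z (zs ++ [ x ]) ⟩
  d + sum (desFrom (suc k) (z ∷ zs ++ [ x ]))
    ≡⟨ cong (d +_) (desFrom-∷ʳ (suc k) (z ∷ zs) x l last) ⟩
  d + (s + (if x <ᵇ l then suc k + length (z ∷ zs) else 0))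
    ≡⟨ +-assoc d s _ ⟨
  d + s + (if x <ᵇ l then suc k + length (z ∷ zs) else 0)
    ≡⟨ cong₂ _+_ (sym (sum-desFrom-∷∷ k y z zs))
                 (cong (λ m → if x <ᵇ l then m else 0) (sym (+-suc k (length (z ∷ zs))))) ⟩
  sum (desFrom k (y ∷ z ∷ zs)) + (if x <ᵇ l then k + length (y ∷ z ∷ zs) else 0) ∎
  where
  open ≡-Reasoning
  d s : ℕ
  d = if z <ᵇ y then suc k else 0
  s = sum (desFrom (suc k) (z ∷ zs))

maj-∷ʳ : ∀ xs x {l} → lastL xs ≡ just l → maj (xs ++ [ x ]) ≡ maj xs + (if x <ᵇ l then length xs else 0)
maj-∷ʳ xs x last = desFrom-∷ʳ 0 xs x _ last

γ-↭ : ∀ x v → γ x v ↭ v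
γ-↭ x v with lastL v in last
... | nothing rewrite lastL≡nothing⇒[] {v} last = ↭-refl
... | just l  = cycleCompartments-↭ _ [] v

γ-cut : ℕ → ℕ → ℕ → Bool
γ-cut x l = if l <ᵇ x then (_<ᵇ x) else (x <ᵇ_)

γ-∷ʳ : ∀ x zs l → γ x (zs ++ [ l ]) ≡ cycleCompartments (γ-cut x l) [] (zs ++ [ l ])
γ-∷ʳ x zs l with lastL (zs ++ [ l ]) | lastL-∷ʳ zs l
... | just .l | refl = refl

module _ {x l : ℕ} {zs : List ℕ} (v≢x : All (_≢ x) (zs ++ [ l ])) where

  private
    v : List ℕ
    v = zs ++ [ l ]
    zs≢x : All (_≢ x) zs
    zs≢x = All.++⁻ˡ zs v≢x

  inv-cycleCompartments-below : l < x → inv (cycleCompartments (_<ᵇ x) [] v) + countGreater x v ≡ inv v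
  inv-cycleCompartments-below l<x = begin
    inv (cycleCompartments (_<ᵇ x) [] v) + countGreater x v
      ≡⟨ cong (inv (cycleCompartments (_<ᵇ x) [] v) +_) (sym (cyclingLoss-below x zs [] zs≢x l<x)) ⟩
    inv (cycleCompartments (_<ᵇ x) [] v) + cyclingLoss (_<ᵇ x) [] v
      ≡⟨ inv-cycleCompartments (_<ᵇ x) [] v ⟩
    inv v + cyclingGain (_<ᵇ x) [] v
      ≡⟨ cong (inv v +_) (cyclingGain-below x v [] v≢x) ⟩
    inv v + 0
      ≡⟨ +-identityʳ (inv v) ⟩
    inv v ∎
    where open ≡-Reasoning

  inv-cycleCompartments-above : x < l →
    inv (cycleCompartments (x <ᵇ_) [] v) + countGreater x v ≡ inv v + length v
  inv-cycleCompartments-above x<l = begin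
    c + g                                      ≡⟨ cong (_+ g) (sym (+-identityʳ c)) ⟩
    c + 0 + g                                  ≡⟨ cong (λ n → c + n + g) (sym (cyclingLoss-above x v [] v≢x)) ⟩
    c + cyclingLoss (x <ᵇ_) [] v + g           ≡⟨ cong (_+ g) (inv-cycleCompartments (x <ᵇ_) [] v) ⟩
    inv v + cyclingGain (x <ᵇ_) [] v + g       ≡⟨ cong (λ n → inv v + n + g) (cyclingGain-above x zs [] zs≢x x<l) ⟩
    inv v + countLess x v + g                  ≡⟨ +-assoc (inv v) _ g ⟩
    inv v + (countLess x v + g)                ≡⟨ cong (inv v +_) (countLess+countGreater x v≢x) ⟩
    inv v + length v                           ∎
    where
    open ≡-Reasoning
    c g : ℕ
    c = inv (cycleCompartments (x <ᵇ_) [] v)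
    g = countGreater x v

  inv-γ-∷ʳ : inv (γ x v ++ [ x ]) ≡ inv v + (if x <ᵇ l then length v else 0)
  inv-γ-∷ʳ = begin
    inv (γ x v ++ [ x ])                   ≡⟨ inv-∷ʳ (γ x v) x ⟩
    inv (γ x v) + countGreater x (γ x v)   ≡⟨ cong₂ _+_ (cong inv (γ-∷ʳ x zs l)) (countᵇ-↭ _ (γ-↭ x v)) ⟩
    inv (cycleCompartments (γ-cut x l) [] v) + countGreater x v ≡⟨ by-cases ⟩
    inv v + (if x <ᵇ l then length v else 0) ∎
    where
    open ≡-Reasoning
    by-cases : inv (cycleCompartments (γ-cut x l) [] v) + countGreater x v ≡
               inv v + (if x <ᵇ l then length v else 0)
    by-cases with <-cmp l x
    ... | tri< l<x _ _ rewrite <⇒<ᵇ≡true l<x | >⇒<ᵇ≡false l<x =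
      trans (inv-cycleCompartments-below l<x) (sym (+-identityʳ (inv v)))
    ... | tri≈ _ l≡x _ = ⊥-elim (All.head (All.++⁻ʳ zs v≢x) l≡x)
    ... | tri> _ _ x<l rewrite <⇒<ᵇ≡true x<l | >⇒<ᵇ≡false x<l = inv-cycleCompartments-above x<l

-- Inverse descents under one step of F₂

-- Letters are 0-based but DES positions 1-based: isIDes a w means a + 1 ∈ IDES w.
isIDes : ℕ → List ℕ → Bool
isIDes a w = indexOf (suc a) w <ᵇ indexOf a w

subword : (ℕ → Bool) → List ℕ → List ℕ
subword q []       = []
subword q (y ∷ ys) = if q y then y ∷ subword q ys else subword q ys

subword-++ : ∀ q xs ys → subword q (xs ++ ys) ≡ subword q xs ++ subword q ys
subword-++ q []       ys = refl
subword-++ q (x ∷ xs) ys with q x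
... | true  = cong (x ∷_) (subword-++ q xs ys)
... | false = subword-++ q xs ys

subword-∷ʳ-reject : ∀ q xs {x} → q x ≡ false → subword q (xs ++ [ x ]) ≡ subword q xs
subword-∷ʳ-reject q xs {x} qx rewrite subword-++ q xs [ x ] | qx = ++-identityʳ _

subword-cycleCompartments-cut : ∀ p cur ys → subword p cur ≡ [] →
  subword p (cycleCompartments p cur ys) ≡ subword p (cur ++ ys)
subword-cycleCompartments-cut p cur [] _ rewrite ++-identityʳ cur = refl
subword-cycleCompartments-cut p cur (y ∷ ys) none with p y in py
... | true rewrite subword-++ p cur (cycleCompartments p [] ys)
                 | subword-++ p cur (y ∷ ys) | none | py =
  cong (y ∷_) (subword-cycleCompartments-cut p [] ys refl)
... | false rewrite sym (++-assoc cur [ y ] ys) =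
  subword-cycleCompartments-cut p (cur ++ [ y ]) ys (trans (subword-∷ʳ-reject p cur py) none)

subword-cycleCompartments-uncut : ∀ p r → (∀ z → p z ≡ true → r z ≡ false) → ∀ cur ys →
  subword r (cycleCompartments p cur ys) ≡ subword r (cur ++ ys)
subword-cycleCompartments-uncut p r disjoint cur [] rewrite ++-identityʳ cur = refl
subword-cycleCompartments-uncut p r disjoint cur (y ∷ ys) with p y in py
... | true rewrite subword-++ r cur (cycleCompartments p [] ys)
                 | subword-++ r cur (y ∷ ys) | disjoint y py =
  cong (subword r cur ++_) (subword-cycleCompartments-uncut p r disjoint [] ys)
... | false rewrite sym (++-assoc cur [ y ] ys) =
  subword-cycleCompartments-uncut p r disjoint (cur ++ [ y ]) ys

subword-γ-below : ∀ x v → subword (_<ᵇ x) (γ x v) ≡ subword (_<ᵇ x) v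
subword-γ-below x v with lastL v in last
... | nothing rewrite lastL≡nothing⇒[] {v} last = refl
... | just l with l <ᵇ x
...   | true  = subword-cycleCompartments-cut (_<ᵇ x) [] v refl
...   | false = subword-cycleCompartments-uncut (x <ᵇ_) (_<ᵇ x)
                  (λ z x<ᵇz → >⇒<ᵇ≡false (<ᵇ≡true⇒< {x} {z} x<ᵇz)) [] v

subword-γ-above : ∀ x v → subword (x <ᵇ_) (γ x v) ≡ subword (x <ᵇ_) v
subword-γ-above x v with lastL v in last
... | nothing rewrite lastL≡nothing⇒[] {v} last = refl
... | just l with l <ᵇ x
...   | true  = subword-cycleCompartments-uncut (_<ᵇ x) (x <ᵇ_)
                  (λ z z<ᵇx → >⇒<ᵇ≡false (<ᵇ≡true⇒< {z} {x} z<ᵇx)) [] v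
...   | false = subword-cycleCompartments-cut (x <ᵇ_) [] v refl

isIDes-subword : ∀ q {a} → q a ≡ true → q (suc a) ≡ true → ∀ u → isIDes a u ≡ isIDes a (subword q u)
isIDes-subword q qa qsa [] = refl
isIDes-subword q {a} qa qsa (y ∷ u) with q y in qy
... | true with a ≡ᵇ y | suc a ≡ᵇ y
...   | true  | _     = refl
...   | false | true  = refl
...   | false | false = isIDes-subword q qa qsa u
isIDes-subword q {a} qa qsa (y ∷ u) | false with a ≡ᵇ y in a≡ᵇy | suc a ≡ᵇ y in sa≡ᵇy
... | true  | _    with () ← trans (sym qa) (trans (cong q (≡ᵇ≡true⇒≡ a≡ᵇy)) qy)
... | false | true with () ← trans (sym qsa) (trans (cong q (≡ᵇ≡true⇒≡ sa≡ᵇy)) qy)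
... | false | false = isIDes-subword q qa qsa u

isIDes-∷ʳ-reject : ∀ q {a x} → q a ≡ true → q (suc a) ≡ true → q x ≡ false → ∀ u →
  isIDes a (u ++ [ x ]) ≡ isIDes a u
isIDes-∷ʳ-reject q {a} {x} qa qsa qx u = begin
  isIDes a (u ++ [ x ])            ≡⟨ isIDes-subword q qa qsa (u ++ [ x ]) ⟩
  isIDes a (subword q (u ++ [ x ])) ≡⟨ cong (isIDes a) (subword-∷ʳ-reject q u qx) ⟩
  isIDes a (subword q u)           ≡⟨ isIDes-subword q qa qsa u ⟨
  isIDes a u                       ∎
  where open ≡-Reasoning

_∈ᵇ_ : ℕ → List ℕ → Bool
z ∈ᵇ []       = false
z ∈ᵇ (y ∷ ys) = (z ≡ᵇ y) ∨ (z ∈ᵇ ys)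

∈ᵇ-↭ : ∀ z {xs ys} → xs ↭ ys → z ∈ᵇ xs ≡ z ∈ᵇ ys
∈ᵇ-↭ z ↭.refl                 = refl
∈ᵇ-↭ z (↭.prep x xs↭ys)       = cong ((z ≡ᵇ x) ∨_) (∈ᵇ-↭ z xs↭ys)
∈ᵇ-↭ z (↭.swap x y xs↭ys) rewrite ∈ᵇ-↭ z xs↭ys with z ≡ᵇ x | z ≡ᵇ y
... | true  | true  = refl
... | true  | false = refl
... | false | _     = refl
∈ᵇ-↭ z (↭.trans xs↭ys ys↭zs)  = trans (∈ᵇ-↭ z xs↭ys) (∈ᵇ-↭ z ys↭zs)

indexOf-∷ʳ-fresh : ∀ x {u} → All (_≢ x) u → indexOf x (u ++ [ x ]) ≡ length u
indexOf-∷ʳ-fresh x []           rewrite ≡ᵇ-refl x = refl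
indexOf-∷ʳ-fresh x (y≢x ∷ u≢x) rewrite ≢⇒≡ᵇ≡false (≢-sym y≢x) = cong suc (indexOf-∷ʳ-fresh x u≢x)

indexOf-∷ʳ<ᵇlength : ∀ {z x} u → z ≢ x → (indexOf z (u ++ [ x ]) <ᵇ length u) ≡ z ∈ᵇ u
indexOf-∷ʳ<ᵇlength         []      _   = refl
indexOf-∷ʳ<ᵇlength {z} (y ∷ u) z≢x with z ≡ᵇ y
... | true  = refl
... | false = indexOf-∷ʳ<ᵇlength u z≢x

length<ᵇindexOf-∷ʳ : ∀ {z x} u → z ≢ x → (length u <ᵇ indexOf z (u ++ [ x ])) ≡ not (z ∈ᵇ u)
length<ᵇindexOf-∷ʳ     {z} {x} []      z≢x rewrite ≢⇒≡ᵇ≡false z≢x = refl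
length<ᵇindexOf-∷ʳ {z}     (y ∷ u) z≢x with z ≡ᵇ y
... | true  = refl
... | false = length<ᵇindexOf-∷ʳ u z≢x

isIDes-∷ʳ : ∀ x {u} → All (_≢ x) u → isIDes x (u ++ [ x ]) ≡ suc x ∈ᵇ u
isIDes-∷ʳ x {u} u≢x rewrite indexOf-∷ʳ-fresh x u≢x = indexOf-∷ʳ<ᵇlength u (λ ())

isIDes-∷ʳ-suc : ∀ a {u} → All (_≢ suc a) u → isIDes a (u ++ [ suc a ]) ≡ not (a ∈ᵇ u)
isIDes-∷ʳ-suc a {u} u≢sa rewrite indexOf-∷ʳ-fresh (suc a) u≢sa = length<ᵇindexOf-∷ʳ u (λ ())

isIDes-γ-∷ʳ : ∀ {w v} x → All (_≢ x) w → v ↭ w → (∀ a → isIDes a v ≡ isIDes a w) →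
  ∀ a → isIDes a (γ x v ++ [ x ]) ≡ isIDes a (w ++ [ x ])
isIDes-γ-∷ʳ {w} {v} x w≢x v↭w ides = by-cases
  where
  open ≡-Reasoning
  γv↭w : γ x v ↭ w
  γv↭w = ↭-trans (γ-↭ x v) v↭w
  γv≢x : All (_≢ x) (γ x v)
  γv≢x = All-resp-↭ (↭-sym γv↭w) w≢x

  x<ᵇx : (x <ᵇ x) ≡ false
  x<ᵇx = ≮⇒<ᵇ≡false (n≮n x)

  same-side : ∀ q {a} → q a ≡ true → q (suc a) ≡ true → q x ≡ false →
    subword q (γ x v) ≡ subword q v → isIDes a (γ x v ++ [ x ]) ≡ isIDes a (w ++ [ x ])
  same-side q {a} qa qsa qx subword≡ = begin
    isIDes a (γ x v ++ [ x ])     ≡⟨ isIDes-∷ʳ-reject q qa qsa qx (γ x v) ⟩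
    isIDes a (γ x v)              ≡⟨ isIDes-subword q qa qsa (γ x v) ⟩
    isIDes a (subword q (γ x v))  ≡⟨ cong (isIDes a) subword≡ ⟩
    isIDes a (subword q v)        ≡⟨ isIDes-subword q qa qsa v ⟨
    isIDes a v                    ≡⟨ ides a ⟩
    isIDes a w                    ≡⟨ isIDes-∷ʳ-reject q qa qsa qx w ⟨
    isIDes a (w ++ [ x ])         ∎

  by-cases : ∀ a → isIDes a (γ x v ++ [ x ]) ≡ isIDes a (w ++ [ x ])
  by-cases a with a ≟ x
  ... | yes refl = begin
    isIDes a (γ a v ++ [ a ]) ≡⟨ isIDes-∷ʳ a γv≢x ⟩
    suc a ∈ᵇ γ a v            ≡⟨ ∈ᵇ-↭ (suc a) γv↭w ⟩
    suc a ∈ᵇ w                ≡⟨ isIDes-∷ʳ a w≢x ⟨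
    isIDes a (w ++ [ a ])     ∎
  ... | no a≢x with suc a ≟ x
  ...   | yes refl = begin
    isIDes a (γ (suc a) v ++ [ suc a ]) ≡⟨ isIDes-∷ʳ-suc a γv≢x ⟩
    not (a ∈ᵇ γ (suc a) v)              ≡⟨ cong not (∈ᵇ-↭ a γv↭w) ⟩
    not (a ∈ᵇ w)                        ≡⟨ isIDes-∷ʳ-suc a w≢x ⟨
    isIDes a (w ++ [ suc a ])           ∎
  ...   | no sa≢x with <-cmp a x
  ...     | tri< a<x _ _ =
    same-side (_<ᵇ x) (<⇒<ᵇ≡true a<x) (<⇒<ᵇ≡true (≤∧≢⇒< a<x sa≢x)) x<ᵇx (subword-γ-below x v)
  ...     | tri≈ _ a≡x _ = ⊥-elim (a≢x a≡x)
  ...     | tri> _ _ x<a =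
    same-side (x <ᵇ_) (<⇒<ᵇ≡true x<a) (<⇒<ᵇ≡true (<-trans x<a (n<1+n a))) x<ᵇx (subword-γ-above x v)

-- The last letter is tracked because it decides how γₓ cuts.
record F₂-Invariant (w v : List ℕ) : Set where
  field
    ↭w      : v ↭ w
    lastL≡  : lastL v ≡ lastL w
    inv≡maj : inv v ≡ maj w
    isIDes≡ : ∀ a → isIDes a v ≡ isIDes a w

F₂-Invariant-∷ʳ : ∀ {w v} x → All (_≢ x) w → F₂-Invariant w v →
  F₂-Invariant (w ++ [ x ]) (γ x v ++ [ x ])
F₂-Invariant-∷ʳ {w} {v} x w≢x I = record
  { ↭w      = ++⁺ʳ [ x ] (↭-trans (γ-↭ x v) ↭w)
  ; lastL≡  = trans (lastL-∷ʳ (γ x v) x) (sym (lastL-∷ʳ w x))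
  ; inv≡maj = inv-step
  ; isIDes≡ = isIDes-γ-∷ʳ x w≢x ↭w isIDes≡
  }
  where
  open F₂-Invariant I
  inv-step : inv (γ x v ++ [ x ]) ≡ maj (w ++ [ x ])
  inv-step with lastL w in last
  ... | nothing with refl ← lastL≡nothing⇒[] {w} last with refl ← ↭-empty-inv ↭w = refl
  ... | just l with zs , refl ← lastL≡just⇒∷ʳ {v} (trans lastL≡ last) = begin
    inv (γ x v ++ [ x ])                      ≡⟨ inv-γ-∷ʳ (All-resp-↭ (↭-sym ↭w) w≢x) ⟩
    inv v + (if x <ᵇ l then length v else 0)  ≡⟨ cong₂ (λ m n → m + (if x <ᵇ l then n else 0))
                                                      inv≡maj (↭-length ↭w) ⟩
    maj w + (if x <ᵇ l then length w else 0)  ≡⟨ maj-∷ʳ w x last ⟨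
    maj (w ++ [ x ])                          ∎
    where open ≡-Reasoning

F₂-from-invariant : ∀ {w v} xs → Unique xs → All (λ x → All (_≢ x) w) xs → F₂-Invariant w v →
  F₂-Invariant (w ++ xs) (F₂-from v xs)
F₂-from-invariant {w}     []       _              _              I rewrite ++-identityʳ w = I
F₂-from-invariant {w} {v} (x ∷ xs) (x≢xs ∷ uxs) (w≢x ∷ fresh) I =
  subst (λ u → F₂-Invariant u (F₂-from (γ x v ++ [ x ]) xs)) (++-assoc w [ x ] xs)
    (F₂-from-invariant xs uxs (All.zipWith extend (fresh , x≢xs)) (F₂-Invariant-∷ʳ x w≢x I))
  where
  extend : ∀ {z} → All (_≢ z) w × x ≢ z → All (_≢ z) (w ++ [ x ])
  extend (w≢z , x≢z) = All.++⁺ w≢z (x≢z ∷ [])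

F₂-invariant : ∀ xs → Unique xs → F₂-Invariant xs (F₂ xs)
F₂-invariant xs uxs = F₂-from-invariant xs uxs (All.universal (λ _ → []) xs) empty
  where
  empty : F₂-Invariant [] []
  empty = record { ↭w = ↭-refl ; lastL≡ = refl ; inv≡maj = refl ; isIDes≡ = λ _ → refl }

countLess-0 : ∀ xs → countLess 0 xs ≡ 0
countLess-0 []       = refl
countLess-0 (x ∷ xs) = countLess-0 xs

countLess-map-suc : ∀ y xs → countLess (suc y) (map suc xs) ≡ countLess y xs
countLess-map-suc y []       = refl
countLess-map-suc y (x ∷ xs) = cong (_ +_) (countLess-map-suc y xs)

inv-map-suc : ∀ xs → inv (map suc xs) ≡ inv xs
inv-map-suc []       = refl
inv-map-suc (x ∷ xs) = cong₂ _+_ (countLess-map-suc x xs) (inv-map-suc xs)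

inv-insert-0 : ∀ xs ys → inv (map suc xs ++ 0 ∷ map suc ys) ≡ length xs + inv (map suc xs ++ map suc ys)
inv-insert-0 []       ys = cong (_+ inv (map suc ys)) (countLess-0 (map suc ys))
inv-insert-0 (x ∷ xs) ys
  rewrite countLess-++ (suc x) (map suc xs) (0 ∷ map suc ys)
        | countLess-++ (suc x) (map suc xs) (map suc ys) | inv-insert-0 xs ys =
  solve 4 (λ a b c d → (a :+ (con 1 :+ b)) :+ (c :+ d) := (con 1 :+ c) :+ ((a :+ b) :+ d)) refl
    (countLess (suc x) (map suc xs)) (countLess (suc x) (map suc ys)) (length xs)
    (inv (map suc xs ++ map suc ys))

increasing-split : ∀ xs y ys → AllPairs _<_ (xs ++ y ∷ ys) →
  All (_< y) xs × All (y <_) ys × AllPairs _<_ (xs ++ ys)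
increasing-split []       y ys (y<ys ∷ inc) = [] , y<ys , inc
increasing-split (x ∷ xs) y ys (x<rest ∷ inc) with increasing-split xs y ys inc
... | xs<y , y<ys , inc′ = All.head x<y∷ys ∷ xs<y , y<ys , All.++⁺ (All.++⁻ˡ xs x<rest) (All.tail x<y∷ys) ∷ inc′
  where
  x<y∷ys : All (x <_) (y ∷ ys)
  x<y∷ys = All.++⁻ʳ xs x<rest

-- For increasing L, map (λ j → indexOf j w) L is w⁻¹ relative to the letters L.  Deleting the
-- first letter y of w deletes the letter 0 of w⁻¹ and lowers the others by one; that 0 sat
-- after exactly the countLess y w letters of L below y.
inv-map-indexOf : ∀ w L → AllPairs _<_ L → L ↭ w → inv (map (λ j → indexOf j w) L) ≡ inv w
inv-map-indexOf []      L _   L↭w with refl ← ↭-empty-inv L↭w = refl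
inv-map-indexOf (y ∷ w) L inc L↭w with L₁ , L₂ , refl ← ∈-∃++ (∈-resp-↭ (↭-sym L↭w) (here refl))
  with L₁<y , y<L₂ , inc′ ← increasing-split L₁ y L₂ inc = begin
  inv (map f (L₁ ++ y ∷ L₂))
    ≡⟨ cong inv (map-++ f L₁ (y ∷ L₂)) ⟩
  inv (map f L₁ ++ f y ∷ map f L₂)
    ≡⟨ cong inv (cong₂ _++_ (shifted L₁≢y) (cong₂ _∷_ fy≡0 (shifted L₂≢y))) ⟩
  inv (map suc (map g L₁) ++ 0 ∷ map suc (map g L₂))
    ≡⟨ inv-insert-0 (map g L₁) (map g L₂) ⟩
  length (map g L₁) + inv (map suc (map g L₁) ++ map suc (map g L₂))
    ≡⟨ cong₂ _+_ (length-map g L₁) (trans (cong inv (sym (map-++ suc (map g L₁) (map g L₂))))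
                                          (inv-map-suc (map g L₁ ++ map g L₂))) ⟩
  length L₁ + inv (map g L₁ ++ map g L₂)
    ≡⟨ cong (λ u → length L₁ + inv u) (map-++ g L₁ L₂) ⟨
  length L₁ + inv (map g (L₁ ++ L₂))
    ≡⟨ cong (length L₁ +_) (inv-map-indexOf w (L₁ ++ L₂) inc′ L₁L₂↭w) ⟩
  length L₁ + inv w
    ≡⟨ cong (_+ inv w) countLess-y ⟨
  countLess y w + inv w ∎
  where
  open ≡-Reasoning
  f g : ℕ → ℕ
  f j = indexOf j (y ∷ w)
  g j = indexOf j w
  L₁L₂↭w : L₁ ++ L₂ ↭ w
  L₁L₂↭w = drop-mid L₁ [] L↭w
  fy≡0 : f y ≡ 0
  fy≡0 rewrite ≡ᵇ-refl y = refl
  shifted : ∀ {M} → All (_≢ y) M → map f M ≡ map suc (map g M)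
  shifted M≢y = trans (map-cong-local (All.map f≡suc∘g M≢y)) (map-∘ _)
    where
    f≡suc∘g : ∀ {j} → j ≢ y → f j ≡ suc (g j)
    f≡suc∘g {j} j≢y rewrite ≢⇒≡ᵇ≡false j≢y = refl
  L₁≢y : All (_≢ y) L₁
  L₁≢y = All.map <⇒≢ L₁<y
  L₂≢y : All (_≢ y) L₂
  L₂≢y = All.map (λ y<j → ≢-sym (<⇒≢ y<j)) y<L₂
  countLess-y : countLess y w ≡ length L₁
  countLess-y = begin
    countLess y w                         ≡⟨ countLess-↭ y L₁L₂↭w ⟨
    countLess y (L₁ ++ L₂)                ≡⟨ countLess-++ y L₁ L₂ ⟩
    countLess y L₁ + countLess y L₂       ≡⟨ cong₂ _+_ (countLess-all< L₁<y) (countLess-all> y<L₂) ⟩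
    length L₁ + 0                         ≡⟨ +-identityʳ _ ⟩
    length L₁                             ∎

-- nth w i = w(i + 1), with junk value 0 past the end.
nth : List ℕ → ℕ → ℕ
nth []       _       = 0
nth (y ∷ ys) zero    = y
nth (y ∷ ys) (suc i) = nth ys i

nth-indexOf : ∀ {z w} → z ∈ w → nth w (indexOf z w) ≡ z
nth-indexOf {z} {y ∷ w} z∈w with z ≡ᵇ y in z≡ᵇy
... | true = sym (≡ᵇ≡true⇒≡ z≡ᵇy)
nth-indexOf {z} {y ∷ w} (here refl) | false with () ← trans (sym (≡ᵇ-refl z)) z≡ᵇy
nth-indexOf {z} {y ∷ w} (there z∈w) | false = nth-indexOf z∈w

indexOf-< : ∀ {z w} → z ∈ w → indexOf z w < length w
indexOf-< {z} {y ∷ w} z∈w with z ≡ᵇ y in z≡ᵇy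
... | true = s≤s z≤n
indexOf-< {z} {y ∷ w} (here refl) | false with () ← trans (sym (≡ᵇ-refl z)) z≡ᵇy
indexOf-< {z} {y ∷ w} (there z∈w) | false = s≤s (indexOf-< z∈w)

nth-∈ : ∀ w {i} → i < length w → nth w i ∈ w
nth-∈ (y ∷ w) {zero}  _         = here refl
nth-∈ (y ∷ w) {suc i} (s≤s i<) = there (nth-∈ w i<)

indexOf-nth : ∀ {w i} → Unique w → i < length w → indexOf (nth w i) w ≡ i
indexOf-nth {y ∷ w} {zero}  _             _        rewrite ≡ᵇ-refl y = refl
indexOf-nth {y ∷ w} {suc i} (y≢w ∷ uw) (s≤s i<)
  rewrite ≢⇒≡ᵇ≡false (≢-sym (All.lookup y≢w (nth-∈ w i<))) = cong suc (indexOf-nth uw i<)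

nth-applyUpTo : ∀ f {n i} → i < n → nth (applyUpTo f n) i ≡ f i
nth-applyUpTo f {suc n} {zero}  _        = refl
nth-applyUpTo f {suc n} {suc i} (s≤s i<) = nth-applyUpTo (f ∘ suc) i<

applyUpTo-nth : ∀ w → applyUpTo (nth w) (length w) ≡ w
applyUpTo-nth []      = refl
applyUpTo-nth (y ∷ w) = cong (y ∷_) (applyUpTo-nth w)

applyUpTo-cong : ∀ {f g : ℕ → ℕ} n → (∀ {i} → i < n → f i ≡ g i) → applyUpTo f n ≡ applyUpTo g n
applyUpTo-cong zero    _   = refl
applyUpTo-cong (suc n) f≡g = cong₂ _∷_ (f≡g (s≤s z≤n)) (applyUpTo-cong n (λ i<n → f≡g (s≤s i<n)))

invW≡applyUpTo : ∀ w → invW w ≡ applyUpTo (λ j → indexOf j w) (length w)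
invW≡applyUpTo w = map-upTo (λ j → indexOf j w) (length w)

module _ {n ρ} (ρ↭ : ρ ↭ upTo n) where

  private
    length-ρ : length ρ ≡ n
    length-ρ = trans (↭-length ρ↭) (length-upTo n)

    unique-ρ : Unique ρ
    unique-ρ = Unique-resp-↭ (setoid ℕ) (↭⇒↭ₛ (↭-sym ρ↭)) (Unique.upTo⁺ n)

    ∈ρ⇒< : ∀ {z} → z ∈ ρ → z < n
    ∈ρ⇒< z∈ρ = ∈-upTo⁻ (∈-resp-↭ ρ↭ z∈ρ)

    <⇒∈ρ : ∀ {z} → z < n → z ∈ ρ
    <⇒∈ρ z<n = ∈-resp-↭ (↭-sym ρ↭) (∈-upTo⁺ z<n)

    <n⇒<length : ∀ {i} → i < n → i < length ρ
    <n⇒<length = subst (_ <_) (sym length-ρ)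

    ρ⁻¹ : ℕ → ℕ
    ρ⁻¹ j = indexOf j ρ

    invW≡applyUpTo-n : invW ρ ≡ applyUpTo ρ⁻¹ n
    invW≡applyUpTo-n = trans (invW≡applyUpTo ρ) (cong (applyUpTo ρ⁻¹) length-ρ)

  unique-invW : Unique (invW ρ)
  unique-invW = subst Unique (sym invW≡applyUpTo-n) (Unique.applyUpTo⁺₁ ρ⁻¹ n injective)
    where
    injective : ∀ {i j} → i < j → j < n → ρ⁻¹ i ≢ ρ⁻¹ j
    injective {i} {j} i<j j<n ρ⁻¹i≡ρ⁻¹j = <⇒≢ i<j (begin
      i              ≡⟨ nth-indexOf (<⇒∈ρ (<-trans i<j j<n)) ⟨
      nth ρ (ρ⁻¹ i)  ≡⟨ cong (nth ρ) ρ⁻¹i≡ρ⁻¹j ⟩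
      nth ρ (ρ⁻¹ j)  ≡⟨ nth-indexOf (<⇒∈ρ j<n) ⟩
      j              ∎)
      where open ≡-Reasoning

  invW-↭-upTo : invW ρ ↭ upTo n
  invW-↭-upTo = ∼bag⇒↭ (unique∧set⇒bag unique-invW (Unique.upTo⁺ n) (mk⇔ ⊆upTo upTo⊆))
    where
    ⊆upTo : ∀ {z} → z ∈ invW ρ → z ∈ upTo n
    ⊆upTo z∈ with i , i<n , refl ← ∈-applyUpTo⁻ ρ⁻¹ (subst (_ ∈_) invW≡applyUpTo-n z∈) =
      ∈-upTo⁺ (subst (ρ⁻¹ i <_) length-ρ (indexOf-< (<⇒∈ρ i<n)))
    upTo⊆ : ∀ {z} → z ∈ upTo n → z ∈ invW ρ
    upTo⊆ {k} k∈ = subst (_ ∈_) (sym invW≡applyUpTo-n)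
      (subst (_∈ applyUpTo ρ⁻¹ n) (indexOf-nth unique-ρ (<n⇒<length k<n))
        (∈-applyUpTo⁺ ρ⁻¹ (∈ρ⇒< (nth-∈ ρ (<n⇒<length k<n)))))
      where
      k<n : k < n
      k<n = ∈-upTo⁻ k∈

  invW-involutive : invW (invW ρ) ≡ ρ
  invW-involutive = begin
    invW π                                    ≡⟨ invW≡applyUpTo π ⟩
    applyUpTo (λ j → indexOf j π) (length π)  ≡⟨ cong (applyUpTo (λ j → indexOf j π)) length-π ⟩
    applyUpTo (λ j → indexOf j π) n           ≡⟨ applyUpTo-cong n indexOf-π ⟩
    applyUpTo (nth ρ) n                       ≡⟨ cong (applyUpTo (nth ρ)) length-ρ ⟨
    applyUpTo (nth ρ) (length ρ)              ≡⟨ applyUpTo-nth ρ ⟩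
    ρ                                         ∎
    where
    open ≡-Reasoning
    π : List ℕ
    π = invW ρ
    length-π : length π ≡ n
    length-π = trans (↭-length invW-↭-upTo) (length-upTo n)
    indexOf-π : ∀ {j} → j < n → indexOf j π ≡ nth ρ j
    indexOf-π {j} j<n = begin
      indexOf j π          ≡⟨ cong (λ k → indexOf k π) nth-π-i ⟨
      indexOf (nth π i) π  ≡⟨ indexOf-nth unique-invW (subst (i <_) (sym length-π) i<n) ⟩
      i                    ∎
      where
      i : ℕ
      i = nth ρ j
      i<n : i < n
      i<n = ∈ρ⇒< (nth-∈ ρ (<n⇒<length j<n))
      nth-π-i : nth π i ≡ j
      nth-π-i = begin
        nth π i                    ≡⟨ cong (λ u → nth u i) invW≡applyUpTo-n ⟩
        nth (applyUpTo ρ⁻¹ n) i    ≡⟨ nth-applyUpTo ρ⁻¹ i<n ⟩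
        ρ⁻¹ i                      ≡⟨ indexOf-nth unique-ρ (<n⇒<length j<n) ⟩
        j                          ∎

  inv-invW : inv (invW ρ) ≡ inv ρ
  inv-invW = begin
    inv (map ρ⁻¹ (upTo (length ρ)))  ≡⟨ cong (λ m → inv (map ρ⁻¹ (upTo m))) length-ρ ⟩
    inv (map ρ⁻¹ (upTo n))           ≡⟨ inv-map-indexOf ρ (upTo n) increasing (↭-sym ρ↭) ⟩
    inv ρ                            ∎
    where
    open ≡-Reasoning
    increasing : AllPairs _<_ (upTo n)
    increasing = AllPairs.applyUpTo⁺₁ id n (λ i<j _ → i<j)

-- pix and descents

data SameDescents : List ℕ → List ℕ → Set where
  []  : SameDescents [] []
  [-] : ∀ {x y} → SameDescents [ x ] [ y ]
  _∷_ : ∀ {x x′ y y′ xs ys} → (x′ <ᵇ x) ≡ (y′ <ᵇ y) →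
        SameDescents (x′ ∷ xs) (y′ ∷ ys) → SameDescents (x ∷ x′ ∷ xs) (y ∷ y′ ∷ ys)

decRun-cong : ∀ {u v} → SameDescents u v → decRun u ≡ decRun v
decRun-cong []          = refl
decRun-cong [-]         = refl
decRun-cong (des≡ ∷ sd) rewrite des≡ | decRun-cong sd = refl

pix-cong : ∀ {u v} → SameDescents u v → pix u ≡ pix v
pix-cong []               = refl
pix-cong [-]              = refl
pix-cong sd@(_ ∷ sd′) rewrite decRun-cong sd | pix-cong sd′ = refl

applyUpTo-SameDescents : ∀ n {f g : ℕ → ℕ} → (∀ k → (f (suc k) <ᵇ f k) ≡ (g (suc k) <ᵇ g k)) →
  SameDescents (applyUpTo f n) (applyUpTo g n)
applyUpTo-SameDescents zero          _    = []
applyUpTo-SameDescents (suc zero)    _    = [-]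
applyUpTo-SameDescents (suc (suc n)) {f} {g} des≡ =
  des≡ 0 ∷ applyUpTo-SameDescents (suc n) {f ∘ suc} {g ∘ suc} (des≡ ∘ suc)

pix-invW-cong : ∀ {u v} → length u ≡ length v → (∀ a → isIDes a u ≡ isIDes a v) →
  pix (invW u) ≡ pix (invW v)
pix-invW-cong {u} {v} length≡ isIDes≡ rewrite invW≡applyUpTo u | invW≡applyUpTo v | length≡ =
  pix-cong (applyUpTo-SameDescents (length v) {λ j → indexOf j u} {λ j → indexOf j v} isIDes≡)

proposition2p8 : (n : ℕ) (ρ : List ℕ) → ρ ↭ upTo n →
    pix (F₂′ ρ) ≡ pix ρ × inv (F₂′ ρ) ≡ imaj ρ
proposition2p8 n ρ ρ↭ = pix-part , inv-part
  where
  π : List ℕ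
  π = invW ρ
  open F₂-Invariant (F₂-invariant π (unique-invW ρ↭))
  σ↭ : F₂ π ↭ upTo n
  σ↭ = ↭-trans ↭w (invW-↭-upTo ρ↭)
  pix-part : pix (invW (F₂ π)) ≡ pix ρ
  pix-part = trans (pix-invW-cong {F₂ π} {π} (↭-length ↭w) isIDes≡) (cong pix (invW-involutive ρ↭))
  inv-part : inv (invW (F₂ π)) ≡ maj π
  inv-part = trans (inv-invW σ↭) inv≡maj
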